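{- Let $m,M$ be positive integers and $L,p$ numbers with $L\geq 2^{m+M}$ and $p\leq 2^{m-1}$. If $T$ is a tournament with $|T|\geq L$, then there are sets of vertices $A,B,E^-,X\subseteq V(T)$ such that: (i) the subtournament on $A\cup B$ is transitive with its tail in $A$ and its head in $B$; (ii) $|A|=m$ and $|B|=M$; (iii) $A$ in-dominates $V(T)\setminus(E^-\cup X)$; (iv) $|X|\leq L$; (v) $d^+(u)\geq p|E^-|$ for every vertex $u\in E^-$, where $d^+$ denotes out-degree in $T$.
   Context: A tournament has exactly one directed edge between each pair of distinct vertices. A tournament is transitive iff its vertices can be ordered $v_1,\dots,v_k$ so that its edges are exactly $v_iv_j$ for $i<j$; then $v_1$ is its tail and $v_k$ its head. A set $S$ of vertices in-dominates a set $B$ if for every $b\in B\setminus S$ there is $s\in S$ such that $bs$ is an edge. -}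

module Defs where

open import Data.Nat using (ℕ; suc; _≤_; _*_)
open import Data.Fin using (Fin; zero; fromℕ; _<_)
open import Data.Fin.Subset using (Subset; _∈_; _∉_; ∣_∣)
open import Data.Bool using (Bool; true; false)
open import Data.Vec using (tabulate)
open import Data.Product using (Σ; _×_; ∃; ∃-syntax)
open import Data.Sum using (_⊎_)
open import Relation.Binary.PropositionalEquality using (_≡_; _≢_)
open import Function.Bundles using (_⇔_)
open import Function.Definitions using (Injective)

record Tournament (n : ℕ) : Set where
  field
    adj     : Fin n → Fin n → Bool
    irrefl  : ∀ i → adj i i ≡ false
    oneEdge : ∀ i j → i ≢ j →
              (adj i j ≡ true × adj j i ≡ false) ⊎ (adj i j ≡ false × adj j i ≡ true)
open Tournament public

Edge : ∀ {n} → Tournament n → Fin n → Fin n → Set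
Edge T u v = adj T u v ≡ true

outDeg : ∀ {n} → Tournament n → Fin n → ℕ
outDeg T u = ∣ tabulate (adj T u) ∣

TransitiveTailHead : ∀ {n} → Tournament n → (S A B : Subset n) → Set
TransitiveTailHead {n} T S A B =
  ∃[ k ] Σ (Fin (suc k) → Fin n) λ v →
    Injective _≡_ _≡_ v
    × (∀ x → (x ∈ S) ⇔ (∃[ i ] v i ≡ x))
    × (∀ i j → Edge T (v i) (v j) ⇔ (i < j))
    × (v zero ∈ A)
    × (v (fromℕ k) ∈ B)

InDominates : ∀ {n} → Tournament n → (S D : Subset n) → Set
InDominates T S D = ∀ b → b ∈ D → b ∉ S → ∃[ s ] (s ∈ S × Edge T b s)

-- Within any vertex set Y of a tournament the out-degrees d⁺_Y sum to |Y|(|Y|−1)/2, so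
-- some vertex of Y has d⁺_Y ≥ (|Y|−1)/2 and some has d⁺_Y ≤ (|Y|−1)/2; in particular
-- fewer than 2t vertices of a set S have fewer than t out-neighbours in S.  Let
-- t = 2^(M+m−1).  The first vertex a₁ of A is a vertex of least out-degree d among those
-- of out-degree ≥ t; then, for k = m−2, …, 0, pass to the out-neighbourhood S of the last
-- chosen vertex and choose in it a vertex of least d⁺_S among those with d⁺_S ≥ 2^(M+k).
-- Such a vertex has d⁺_S ≤ (|S| + 2^(M+k+1))/2, so the common out-neighbourhood C of A
-- satisfies |C| ≥ 2^M and 2^(m−1) (|C| − (m−1) 2^M) ≤ d.  Erdős–Moser inside C gives B,
-- and every vertex outside A ∪ C sends an edge to A.  Finally E⁻ is a set of at most
-- |C| − (m−1) 2^M vertices of C of out-degree ≥ t (hence ≥ d) and X = C ∖ E⁻: either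
-- |X| ≤ (m−1) 2^M, or all of X has out-degree < t and so |X| < 2t ≤ L.
module Submission where

open import Data.Bool using (Bool; true; false; _∧_)
open import Data.Fin as Fin using (Fin; zero; suc; _↑ˡ_; _↑ʳ_; splitAt)
import Data.Fin.Properties as Finₚ
open import Data.Fin.Subset
open import Data.Fin.Subset.Properties
open import Data.Nat using (ℕ; zero; suc; _+_; _*_; _^_; _∸_; _≤_; _<_; z≤n; s≤s; s≤s⁻¹; _≤?_; _<?_; >-nonZero)
open import Data.Nat.Induction using (<-wellFounded)
open import Data.Nat.Properties
open import Algebra.Properties.Semiring.Sum +-*-semiring
  using (sum-syntax; sum-cong-≗; sum-replicate-zero; ∑-distrib-+; ∑-comm; *-distribˡ-sum; *-distribʳ-sum)
open import Data.Nat.Tactic.RingSolver using (solve-∀)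
open import Data.Product using (Σ; _×_; _,_; proj₁; proj₂; ∃-syntax)
open import Data.Sum using (_⊎_; inj₁; inj₂; [_,_]′)
open import Data.Vec using (_∷_; []; lookup; tabulate; here; there)
open import Data.Vec.Properties using (lookup∘tabulate; lookup-zipWith; []=⇒lookup; lookup⇒[]=)
import Data.Vec.Functional as Vector
open import Data.Vec.Functional using (_++_)
open import Data.Vec.Functional.Properties using (lookup-++ˡ; lookup-++ʳ)
open import Function using (id; _∘_; _⇔_; mk⇔; Equivalence)
open import Function.Definitions using (Injective)
open import Induction.WellFounded using (Acc; acc)
open import Relation.Binary.Definitions using (tri<; tri≈; tri>)
open import Relation.Binary.PropositionalEquality
open import Relation.Nullary using (¬_; yes; no; does; contradiction)
open import Relation.Nullary.Decidable using (_×-dec_; dec-true; dec-false)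

open import Defs

private variable
  n : ℕ

n<2^n : ∀ n → n < 2 ^ n
n<2^n zero    = s≤s z≤n
n<2^n (suc n) = +-mono-≤ (m^n>0 2 n) (≤-trans (n<2^n n) (m≤m+n (2 ^ n) 0))

m*2^k≤2^[1+m+k] : ∀ m k → m * 2 ^ k ≤ 2 ^ (suc m + k)
m*2^k≤2^[1+m+k] m k = begin
  m * 2 ^ k          ≤⟨ *-monoˡ-≤ (2 ^ k) (≤-trans (n≤1+n m) (<⇒≤ (n<2^n (suc m)))) ⟩
  2 ^ suc m * 2 ^ k  ≡⟨ ^-distribˡ-+-* 2 (suc m) k ⟨
  2 ^ (suc m + k)    ∎
  where open ≤-Reasoning

2^[1+m+k]≡2*2^[k+m] : ∀ m k → 2 ^ (suc m + k) ≡ 2 * 2 ^ (k + m)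
2^[1+m+k]≡2*2^[k+m] m k = cong (λ e → 2 * 2 ^ e) (+-comm m k)

suc[2m+1]≡2[1+m] : ∀ m → suc (2 * m + 1) ≡ 2 * suc m
suc[2m+1]≡2[1+m] = solve-∀

m+[n∸o]≤n⇒m≤o : ∀ m n o → m + (n ∸ o) ≤ n → m ≤ o
m+[n∸o]≤n⇒m≤o m n o m+[n∸o]≤n with ≤-total o n
... | inj₁ o≤n = +-cancelʳ-≤ (n ∸ o) m o (≤-trans m+[n∸o]≤n (≤-reflexive (sym (m+[n∸m]≡n o≤n))))
... | inj₂ n≤o = ≤-trans (m≤m+n m (n ∸ o)) (≤-trans m+[n∸o]≤n n≤o)

m*n≤o+m*p⇒m*[n∸p]≤o : ∀ m n p o → m * n ≤ o + m * p → m * (n ∸ p) ≤ o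
m*n≤o+m*p⇒m*[n∸p]≤o m n p o mn≤o+mp = begin
  m * (n ∸ p)     ≡⟨ *-distribˡ-∸ m n p ⟩
  m * n ∸ m * p   ≤⟨ m≤n+o⇒m∸n≤o (m * n) (m * p) (≤-trans mn≤o+mp (≤-reflexive (+-comm o (m * p)))) ⟩
  o               ∎
  where open ≤-Reasoning

-- Sums of indicator functions of subsets

indicator : Side → ℕ
indicator inside  = 1
indicator outside = 0

χ : Subset n → Fin n → ℕ
χ p i = indicator (lookup p i)

∣p∣≡∑χ : (p : Subset n) → ∣ p ∣ ≡ ∑[ i < n ] χ p i
∣p∣≡∑χ []            = refl
∣p∣≡∑χ (inside  ∷ p) = cong suc (∣p∣≡∑χ p)
∣p∣≡∑χ (outside ∷ p) = ∣p∣≡∑χ p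

χ-∈ : {p : Subset n} {x : Fin n} → x ∈ p → χ p x ≡ 1
χ-∈ x∈p rewrite []=⇒lookup x∈p = refl

χ-∉ : {p : Subset n} {x : Fin n} → x ∉ p → χ p x ≡ 0
χ-∉ {p = p} {x} x∉p with lookup p x in eq
... | inside  = contradiction (lookup⇒[]= x p eq) x∉p
... | outside = refl

χ-∩ : (p q : Subset n) (i : Fin n) → χ (p ∩ q) i ≡ χ p i * χ q i
χ-∩ p q i rewrite lookup-zipWith _∧_ i p q with lookup p i | lookup q i
... | inside  | inside  = refl
... | inside  | outside = refl
... | outside | _       = refl

χ-tabulate : (f : Fin n → Bool) (x : Fin n) → χ (tabulate f) x ≡ indicator (f x)
χ-tabulate f x = cong indicator (lookup∘tabulate f x)

∣p∩q∣≡∑χχ : (p q : Subset n) → ∣ p ∩ q ∣ ≡ ∑[ i < n ] (χ p i * χ q i)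
∣p∩q∣≡∑χχ p q = trans (∣p∣≡∑χ (p ∩ q)) (sum-cong-≗ (χ-∩ p q))

∑-χ⁅⁆ : (f : Fin n → ℕ) (v : Fin n) → ∑[ w < n ] (f w * χ ⁅ v ⁆ w) ≡ f v
∑-χ⁅⁆ {suc n} f zero = begin
  f zero * 1 + ∑[ w < n ] (f (suc w) * χ ⊥ w)  ≡⟨ cong₂ _+_ (*-identityʳ (f zero)) (sum-cong-≗ vanish) ⟩
  f zero + ∑[ w < n ] 0                       ≡⟨ cong (f zero +_) (sum-replicate-zero n) ⟩
  f zero + 0                                  ≡⟨ +-identityʳ (f zero) ⟩
  f zero                                      ∎
  where
  open ≡-Reasoning
  vanish : ∀ w → f (suc w) * χ ⊥ w ≡ 0
  vanish w rewrite χ-∉ {p = ⊥} {w} ∉⊥ = *-zeroʳ (f (suc w))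
∑-χ⁅⁆ {suc n} f (suc v) =
  trans (cong (_+ ∑[ w < n ] (f (suc w) * χ ⁅ v ⁆ w)) (*-zeroʳ (f zero))) (∑-χ⁅⁆ (f ∘ suc) v)

∑-mono-≤ : {f g : Fin n → ℕ} → (∀ i → f i ≤ g i) → ∑[ i < n ] f i ≤ ∑[ i < n ] g i
∑-mono-≤ {zero}  f≤g = z≤n
∑-mono-≤ {suc n} f≤g = +-mono-≤ (f≤g zero) (∑-mono-≤ (f≤g ∘ suc))

x∈p⇒0<∣p∣ : {p : Subset n} {x : Fin n} → x ∈ p → 0 < ∣ p ∣
x∈p⇒0<∣p∣ x∈p = ≤-<-trans z≤n (x∈p⇒∣p-x∣<∣p∣ x∈p)

Empty⇒∣p∣≡0 : {p : Subset n} → Empty p → ∣ p ∣ ≡ 0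
Empty⇒∣p∣≡0 {n} empty = trans (cong ∣_∣ (Empty-unique empty)) (∣⊥∣≡0 n)

0<∣p∣⇒Nonempty : {p : Subset n} → 0 < ∣ p ∣ → Nonempty p
0<∣p∣⇒Nonempty {p = p} 0<∣p∣ with nonempty? p
... | yes ne    = ne
... | no  empty = contradiction (Empty⇒∣p∣≡0 empty) (>⇒≢ 0<∣p∣)

module _ (Y : Subset n) where

  ∑χ-mono-≤ : {f g : Fin n → ℕ} → (∀ {v} → v ∈ Y → f v ≤ g v) →
              ∑[ v < n ] (χ Y v * f v) ≤ ∑[ v < n ] (χ Y v * g v)
  ∑χ-mono-≤ {f} {g} f≤g = ∑-mono-≤ pointwise
    where
    pointwise : ∀ v → χ Y v * f v ≤ χ Y v * g v
    pointwise v with v ∈? Y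
    ... | yes v∈Y rewrite χ-∈ v∈Y = *-monoʳ-≤ 1 (f≤g v∈Y)
    ... | no  v∉Y rewrite χ-∉ v∉Y = z≤n

  ∑χ-cong : {f g : Fin n → ℕ} → (∀ {v} → v ∈ Y → f v ≡ g v) →
            ∑[ v < n ] (χ Y v * f v) ≡ ∑[ v < n ] (χ Y v * g v)
  ∑χ-cong f≡g = ≤-antisym (∑χ-mono-≤ (≤-reflexive ∘ f≡g)) (∑χ-mono-≤ (≤-reflexive ∘ sym ∘ f≡g))

  ∑χ-const : (c : ℕ) → ∑[ v < n ] (χ Y v * c) ≡ ∣ Y ∣ * c
  ∑χ-const c = trans (sym (*-distribʳ-sum c (χ Y))) (cong (_* c) (sym (∣p∣≡∑χ Y)))

  ∑χ-suc : (f : Fin n → ℕ) → ∑[ v < n ] (χ Y v * suc (f v)) ≡ ∑[ v < n ] (χ Y v * f v) + ∣ Y ∣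
  ∑χ-suc f = begin
    ∑[ v < n ] (χ Y v * suc (f v))               ≡⟨ sum-cong-≗ (λ v → trans (*-suc (χ Y v) (f v)) (+-comm (χ Y v) _)) ⟩
    ∑[ v < n ] (χ Y v * f v + χ Y v)             ≡⟨ ∑-distrib-+ (λ v → χ Y v * f v) (χ Y) ⟩
    ∑[ v < n ] (χ Y v * f v) + ∑[ v < n ] χ Y v  ≡⟨ cong (∑[ v < n ] (χ Y v * f v) +_) (sym (∣p∣≡∑χ Y)) ⟩
    ∑[ v < n ] (χ Y v * f v) + ∣ Y ∣             ∎
    where open ≡-Reasoning

  ∃-≥-average : (f : Fin n → ℕ) (c : ℕ) → Nonempty Y →
                ∣ Y ∣ * c ≤ ∑[ v < n ] (χ Y v * f v) → ∃[ v ] (v ∈ Y × c ≤ f v)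
  ∃-≥-average f c (y , y∈Y) average≥c with Finₚ.any? (λ v → v ∈? Y ×-dec c ≤? f v)
  ... | yes found = found
  ... | no  none  = contradiction average≥c (<⇒≱ average<c)
    where
    average<c : ∑[ v < n ] (χ Y v * f v) < ∣ Y ∣ * c
    average<c = begin-strict
      ∑[ v < n ] (χ Y v * f v)          <⟨ m<m+n _ (x∈p⇒0<∣p∣ y∈Y) ⟩
      ∑[ v < n ] (χ Y v * f v) + ∣ Y ∣  ≡⟨ ∑χ-suc f ⟨
      ∑[ v < n ] (χ Y v * suc (f v))    ≤⟨ ∑χ-mono-≤ (λ v∈Y → ≰⇒> (λ c≤fv → none (_ , v∈Y , c≤fv))) ⟩
      ∑[ v < n ] (χ Y v * c)            ≡⟨ ∑χ-const c ⟩
      ∣ Y ∣ * c                         ∎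
      where open ≤-Reasoning

  ∃-≤-average : (f : Fin n → ℕ) (c : ℕ) → Nonempty Y →
                ∑[ v < n ] (χ Y v * f v) ≤ ∣ Y ∣ * c → ∃[ v ] (v ∈ Y × f v ≤ c)
  ∃-≤-average f c (y , y∈Y) average≤c with Finₚ.any? (λ v → v ∈? Y ×-dec f v ≤? c)
  ... | yes found = found
  ... | no  none  = contradiction average≤c (<⇒≱ average>c)
    where
    average>c : ∣ Y ∣ * c < ∑[ v < n ] (χ Y v * f v)
    average>c = begin-strict
      ∣ Y ∣ * c                   <⟨ *-monoʳ-< ∣ Y ∣ {{>-nonZero (x∈p⇒0<∣p∣ y∈Y)}} (n<1+n c) ⟩
      ∣ Y ∣ * suc c               ≡⟨ ∑χ-const (suc c) ⟨
      ∑[ v < n ] (χ Y v * suc c)  ≤⟨ ∑χ-mono-≤ (λ v∈Y → ≰⇒> (λ fv≤c → none (_ , v∈Y , fv≤c))) ⟩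
      ∑[ v < n ] (χ Y v * f v)    ∎
      where open ≤-Reasoning

∣p∩r∣-split : (p q r : Subset n) → ∣ p ∩ r ∣ ≡ ∣ (p ∩ q) ∩ r ∣ + ∣ (p ∩ ∁ q) ∩ r ∣
∣p∩r∣-split []            []            []            = refl
∣p∩r∣-split (inside  ∷ p) (inside  ∷ q) (inside  ∷ r) = cong suc (∣p∩r∣-split p q r)
∣p∩r∣-split (inside  ∷ p) (outside ∷ q) (inside  ∷ r) = trans (cong suc (∣p∩r∣-split p q r)) (sym (+-suc _ _))
∣p∩r∣-split (inside  ∷ p) (inside  ∷ q) (outside ∷ r) = ∣p∩r∣-split p q r
∣p∩r∣-split (inside  ∷ p) (outside ∷ q) (outside ∷ r) = ∣p∩r∣-split p q r
∣p∩r∣-split (outside ∷ p) (_       ∷ q) (_       ∷ r) = ∣p∩r∣-split p q r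

∣p∣-split : (p q : Subset n) → ∣ p ∣ ≡ ∣ p ∩ q ∣ + ∣ p ∩ ∁ q ∣
∣p∣-split p q = begin
  ∣ p ∣                                ≡⟨ cong ∣_∣ (∩-identityʳ p) ⟨
  ∣ p ∩ ⊤ ∣                            ≡⟨ ∣p∩r∣-split p q ⊤ ⟩
  ∣ (p ∩ q) ∩ ⊤ ∣ + ∣ (p ∩ ∁ q) ∩ ⊤ ∣  ≡⟨ cong₂ (λ r s → ∣ r ∣ + ∣ s ∣) (∩-identityʳ (p ∩ q)) (∩-identityʳ (p ∩ ∁ q)) ⟩
  ∣ p ∩ q ∣ + ∣ p ∩ ∁ q ∣              ∎
  where open ≡-Reasoning

p⊆q∪[p∩∁q] : (p q : Subset n) → p ⊆ q ∪ (p ∩ ∁ q)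
p⊆q∪[p∩∁q] p q {x} x∈p with x ∈? q
... | yes x∈q = x∈p∪q⁺ (inj₁ x∈q)
... | no  x∉q = x∈p∪q⁺ (inj₂ (x∈p∩q⁺ (x∈p , x∉p⇒x∈∁p x∉q)))

∈-tabulate : {f : Fin n → Bool} {x : Fin n} → x ∈ tabulate f ⇔ f x ≡ true
∈-tabulate {f = f} {x} = mk⇔
  (λ x∈f → trans (sym (lookup∘tabulate f x)) ([]=⇒lookup x∈f))
  (λ fx → lookup⇒[]= x (tabulate f) (trans (lookup∘tabulate f x) fx))

below : (Fin n → ℕ) → ℕ → Subset n
below f t = tabulate (λ v → does (f v <? t))

∈-below⁺ : {f : Fin n → ℕ} {t : ℕ} {x : Fin n} → f x < t → x ∈ below f t
∈-below⁺ {f = f} {t} {x} fx<t = Equivalence.from ∈-tabulate (dec-true (f x <? t) fx<t)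

∈-below⁻ : {f : Fin n → ℕ} {t : ℕ} {x : Fin n} → x ∈ below f t → f x < t
∈-below⁻ {f = f} {t} {x} x∈below with f x <? t
... | yes fx<t = fx<t
... | no  fx≮t = contradiction (trans (sym (Equivalence.to ∈-tabulate x∈below)) (dec-false (f x <? t) fx≮t)) λ ()

∃-argmin : (f : Fin n → ℕ) {p : Subset n} → Nonempty p → ∃[ a ] (a ∈ p × (∀ {v} → v ∈ p → f a ≤ f v))
∃-argmin f {p} (x , x∈p) = descend x x∈p (<-wellFounded (f x))
  where
  descend : ∀ x → x ∈ p → Acc _<_ (f x) → ∃[ a ] (a ∈ p × (∀ {v} → v ∈ p → f a ≤ f v))
  descend x x∈p (acc smaller) with Finₚ.any? (λ v → v ∈? p ×-dec f v <? f x)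
  ... | yes (v , v∈p , fv<fx) = descend v v∈p (smaller fv<fx)
  ... | no  none              = x , x∈p , λ v∈p → ≮⇒≥ (λ fv<fx → none (_ , v∈p , fv<fx))

∃-⊆-of-size : (D : Subset n) {r : ℕ} → r ≤ ∣ D ∣ → ∃[ E ] (E ⊆ D × ∣ E ∣ ≡ r)
∃-⊆-of-size []            z≤n = [] , id , refl
∃-⊆-of-size (outside ∷ D) r≤∣D∣ =
  let E , E⊆D , ∣E∣≡r = ∃-⊆-of-size D r≤∣D∣ in outside ∷ E , s⊆s E⊆D , ∣E∣≡r
∃-⊆-of-size {suc n} (inside ∷ D) {zero} _ = ⊥ , ⊥⊆ , ∣⊥∣≡0 (suc n)
∃-⊆-of-size (inside ∷ D) {suc r} 1+r≤1+∣D∣ =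
  let E , E⊆D , ∣E∣≡r = ∃-⊆-of-size D (s≤s⁻¹ 1+r≤1+∣D∣) in inside ∷ E , s⊆s E⊆D , cong suc ∣E∣≡r

∃-truncation : (C H : Subset n) (r : ℕ) →
               ∃[ E ] (E ⊆ C ∩ H × ∣ E ∣ ≤ r × (∣ C ∩ ∁ E ∣ + r ≤ ∣ C ∣ ⊎ C ∩ ∁ E ⊆ ∁ H))
∃-truncation C H r with r ≤? ∣ C ∩ H ∣
... | yes r≤∣C∩H∣ =
  let E , E⊆C∩H , ∣E∣≡r = ∃-⊆-of-size (C ∩ H) r≤∣C∩H∣
      E⊆C∩E : E ⊆ C ∩ E
      E⊆C∩E x∈E = x∈p∩q⁺ (proj₁ (x∈p∩q⁻ C H (E⊆C∩H x∈E)) , x∈E)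
  in E , E⊆C∩H , ≤-reflexive ∣E∣≡r , inj₁ (begin
    ∣ C ∩ ∁ E ∣ + r          ≡⟨ +-comm (∣ C ∩ ∁ E ∣) r ⟩
    r + ∣ C ∩ ∁ E ∣          ≤⟨ +-monoˡ-≤ (∣ C ∩ ∁ E ∣) (≤-trans (≤-reflexive (sym ∣E∣≡r)) (p⊆q⇒∣p∣≤∣q∣ E⊆C∩E)) ⟩
    ∣ C ∩ E ∣ + ∣ C ∩ ∁ E ∣  ≡⟨ ∣p∣-split C E ⟨
    ∣ C ∣                    ∎)
  where open ≤-Reasoning
... | no  r≰∣C∩H∣ = C ∩ H , id , <⇒≤ (≰⇒> r≰∣C∩H∣) , inj₂ λ {x} x∈C∖[C∩H] →
  let x∈C , x∉C∩H = x∈p∩q⁻ C (∁ (C ∩ H)) x∈C∖[C∩H]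
  in x∉p⇒x∈∁p (λ x∈H → x∈∁p⇒x∉p x∉C∩H (x∈p∩q⁺ (x∈C , x∈H)))

image : {k : ℕ} → (Fin k → Fin n) → Subset n
image {k = zero}  a = ⊥
image {k = suc k} a = ⁅ a zero ⁆ ∪ image (a ∘ suc)

∈-image⁺ : {k : ℕ} (a : Fin k → Fin n) (i : Fin k) → a i ∈ image a
∈-image⁺ a zero    = x∈p∪q⁺ (inj₁ (x∈⁅x⁆ (a zero)))
∈-image⁺ a (suc i) = x∈p∪q⁺ (inj₂ (∈-image⁺ (a ∘ suc) i))

∈-image⁻ : {k : ℕ} (a : Fin k → Fin n) {x : Fin n} → x ∈ image a → ∃[ i ] (a i ≡ x)
∈-image⁻ {k = zero}  a x∈⊥ = contradiction x∈⊥ ∉⊥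
∈-image⁻ {k = suc k} a x∈image with x∈p∪q⁻ ⁅ a zero ⁆ (image (a ∘ suc)) x∈image
... | inj₁ x∈⁅a₀⁆    = zero , sym (x∈⁅y⁆⇒x≡y (a zero) x∈⁅a₀⁆)
... | inj₂ x∈image′ = let i , aᵢ≡x = ∈-image⁻ (a ∘ suc) x∈image′ in suc i , aᵢ≡x

∣⁅x⁆∪p∣ : {x : Fin n} {p : Subset n} → x ∉ p → ∣ ⁅ x ⁆ ∪ p ∣ ≡ suc ∣ p ∣
∣⁅x⁆∪p∣ {x = zero}  {outside ∷ p} _   = cong (suc ∘ ∣_∣) (∪-identityˡ p)
∣⁅x⁆∪p∣ {x = zero}  {inside  ∷ p} x∉p = contradiction here x∉p
∣⁅x⁆∪p∣ {x = suc x} {outside ∷ p} x∉p = ∣⁅x⁆∪p∣ (x∉p ∘ there)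
∣⁅x⁆∪p∣ {x = suc x} {inside  ∷ p} x∉p = cong suc (∣⁅x⁆∪p∣ (x∉p ∘ there))

∣image∣ : {k : ℕ} (a : Fin k → Fin n) → Injective _≡_ _≡_ a → ∣ image a ∣ ≡ k
∣image∣ {n} {zero}  a _     = ∣⊥∣≡0 n
∣image∣ {n} {suc k} a a-inj =
  trans (∣⁅x⁆∪p∣ a₀∉image′) (cong suc (∣image∣ (a ∘ suc) (Finₚ.suc-injective ∘ a-inj)))
  where
  a₀∉image′ : a zero ∉ image (a ∘ suc)
  a₀∉image′ a₀∈image′ with ∈-image⁻ (a ∘ suc) a₀∈image′
  ... | i , aᵢ≡a₀ with () ← a-inj aᵢ≡a₀

↑ˡ-or-↑ʳ : {k l : ℕ} (i : Fin (k + l)) → (∃[ x ] i ≡ x ↑ˡ l) ⊎ (∃[ y ] i ≡ k ↑ʳ y)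
↑ˡ-or-↑ʳ {k} i with splitAt k i in eq
... | inj₁ x = inj₁ (x , sym (Finₚ.splitAt⁻¹-↑ˡ eq))
... | inj₂ y = inj₂ (y , sym (Finₚ.splitAt⁻¹-↑ʳ eq))

-- Out-degrees inside a subset

module _ (T : Tournament n) where

  N⁺ N⁻ : Fin n → Subset n
  N⁺ u = tabulate (adj T u)
  N⁻ v = tabulate (λ u → adj T u v)

  d⁺ d⁻ : Subset n → Fin n → ℕ
  d⁺ S u = ∣ S ∩ N⁺ u ∣
  d⁻ S v = ∣ S ∩ N⁻ v ∣

  ∈N⁺⇒edge : {u v : Fin n} → v ∈ N⁺ u → Edge T u v
  ∈N⁺⇒edge = Equivalence.to ∈-tabulate

  edge⇒∈N⁺ : {u v : Fin n} → Edge T u v → v ∈ N⁺ u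
  edge⇒∈N⁺ = Equivalence.from ∈-tabulate

  d⁺⊤≡outDeg : (u : Fin n) → d⁺ ⊤ u ≡ outDeg T u
  d⁺⊤≡outDeg u = cong ∣_∣ (∩-identityˡ (N⁺ u))

  edge-irrefl : {u : Fin n} → ¬ Edge T u u
  edge-irrefl {u} uu = contradiction (trans (sym uu) (irrefl T u)) λ ()

  edge-asym : {u v : Fin n} → Edge T u v → ¬ Edge T v u
  edge-asym {u} {v} uv vu with u Finₚ.≟ v
  ... | yes refl = edge-irrefl uv
  ... | no  u≢v with oneEdge T u v u≢v
  ...   | inj₁ (_ , ¬vu) = contradiction (trans (sym vu) ¬vu) λ ()
  ...   | inj₂ (¬uv , _) = contradiction (trans (sym uv) ¬uv) λ ()

  ¬edge⇒edge : {u v : Fin n} → u ≢ v → ¬ Edge T u v → Edge T v u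
  ¬edge⇒edge {u} {v} u≢v ¬uv with oneEdge T u v u≢v
  ... | inj₁ (uv , _) = contradiction uv ¬uv
  ... | inj₂ (_ , vu) = vu

  χN⁺≡χN⁻ : (u v : Fin n) → χ (N⁺ u) v ≡ χ (N⁻ v) u
  χN⁺≡χN⁻ u v = trans (χ-tabulate (adj T u) v) (sym (χ-tabulate (λ w → adj T w v) u))

  N⁺-N⁻-⁅⁆-partition : (v w : Fin n) → χ (N⁺ v) w + χ (N⁻ v) w + χ ⁅ v ⁆ w ≡ 1
  N⁺-N⁻-⁅⁆-partition v w
    rewrite χ-tabulate (adj T v) w | χ-tabulate (λ u → adj T u v) w with v Finₚ.≟ w
  ... | yes refl rewrite irrefl T v | χ-∈ (x∈⁅x⁆ v) = refl
  ... | no  v≢w rewrite χ-∉ (x≢y⇒x∉⁅y⁆ (v≢w ∘ sym)) with oneEdge T v w v≢w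
  ...   | inj₁ (vw , wv) rewrite vw | wv = refl
  ...   | inj₂ (vw , wv) rewrite vw | wv = refl

  d⁺+d⁻+1≡∣Y∣ : {Y : Subset n} {v : Fin n} → v ∈ Y → d⁺ Y v + d⁻ Y v + 1 ≡ ∣ Y ∣
  d⁺+d⁻+1≡∣Y∣ {Y} {v} v∈Y = begin
    d⁺ Y v + d⁻ Y v + 1
      ≡⟨ cong₂ (λ a b → a + b + 1) (∣p∩q∣≡∑χχ Y (N⁺ v)) (∣p∩q∣≡∑χχ Y (N⁻ v)) ⟩
    ∑[ w < n ] (y w * χ (N⁺ v) w) + ∑[ w < n ] (y w * χ (N⁻ v) w) + 1
      ≡⟨ cong (∑[ w < n ] (y w * χ (N⁺ v) w) + ∑[ w < n ] (y w * χ (N⁻ v) w) +_)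
              (sym (trans (∑-χ⁅⁆ y v) (χ-∈ v∈Y))) ⟩
    ∑[ w < n ] (y w * χ (N⁺ v) w) + ∑[ w < n ] (y w * χ (N⁻ v) w) + ∑[ w < n ] (y w * χ ⁅ v ⁆ w)
      ≡⟨ cong (_+ ∑[ w < n ] (y w * χ ⁅ v ⁆ w)) (∑-distrib-+ (λ w → y w * χ (N⁺ v) w) _) ⟨
    ∑[ w < n ] (y w * χ (N⁺ v) w + y w * χ (N⁻ v) w) + ∑[ w < n ] (y w * χ ⁅ v ⁆ w)
      ≡⟨ ∑-distrib-+ (λ w → y w * χ (N⁺ v) w + y w * χ (N⁻ v) w) _ ⟨
    ∑[ w < n ] (y w * χ (N⁺ v) w + y w * χ (N⁻ v) w + y w * χ ⁅ v ⁆ w)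
      ≡⟨ sum-cong-≗ (λ w → trans (distrib³ (y w) _ _ _) (cong (y w *_) (N⁺-N⁻-⁅⁆-partition v w))) ⟩
    ∑[ w < n ] (y w * 1)
      ≡⟨ sum-cong-≗ (λ w → *-identityʳ (y w)) ⟩
    ∑[ w < n ] y w
      ≡⟨ ∣p∣≡∑χ Y ⟨
    ∣ Y ∣ ∎
    where
    open ≡-Reasoning
    y = χ Y
    distrib³ : ∀ a b c d → a * b + a * c + a * d ≡ a * (b + c + d)
    distrib³ = solve-∀

  χ*∣∩∣ : (Y q : Subset n) (v : Fin n) → χ Y v * ∣ Y ∩ q ∣ ≡ ∑[ w < n ] (χ Y v * (χ Y w * χ q w))
  χ*∣∩∣ Y q v = trans (cong (χ Y v *_) (∣p∩q∣≡∑χχ Y q)) (*-distribˡ-sum (χ Y v) (λ w → χ Y w * χ q w))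

  ∑d⁺≡∑d⁻ : (Y : Subset n) → ∑[ v < n ] (χ Y v * d⁺ Y v) ≡ ∑[ v < n ] (χ Y v * d⁻ Y v)
  ∑d⁺≡∑d⁻ Y = begin
    ∑[ v < n ] (χ Y v * d⁺ Y v)
      ≡⟨ sum-cong-≗ (λ v → χ*∣∩∣ Y (N⁺ v) v) ⟩
    ∑[ v < n ] ∑[ w < n ] (χ Y v * (χ Y w * χ (N⁺ v) w))
      ≡⟨ ∑-comm (λ v w → χ Y v * (χ Y w * χ (N⁺ v) w)) ⟩
    ∑[ w < n ] ∑[ v < n ] (χ Y v * (χ Y w * χ (N⁺ v) w))
      ≡⟨ sum-cong-≗ (λ w → sum-cong-≗ (λ v → swap (χ Y v) (χ Y w) (χN⁺≡χN⁻ v w))) ⟩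
    ∑[ w < n ] ∑[ v < n ] (χ Y w * (χ Y v * χ (N⁻ w) v))
      ≡⟨ sum-cong-≗ (λ w → χ*∣∩∣ Y (N⁻ w) w) ⟨
    ∑[ w < n ] (χ Y w * d⁻ Y w) ∎
    where
    open ≡-Reasoning
    swap : ∀ a b {c d} → c ≡ d → a * (b * c) ≡ b * (a * d)
    swap a b {c} refl = trans (sym (*-assoc a b c)) (trans (cong (_* c) (*-comm a b)) (*-assoc b a c))

  ∑-2d⁺+1 : (Y : Subset n) → ∑[ v < n ] (χ Y v * (2 * d⁺ Y v + 1)) ≡ ∣ Y ∣ * ∣ Y ∣
  ∑-2d⁺+1 Y = begin
    ∑[ v < n ] (y v * (2 * d⁺ Y v + 1))
      ≡⟨ sum-cong-≗ (λ v → twice (y v) (d⁺ Y v)) ⟩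
    ∑[ v < n ] (y v * d⁺ Y v + y v * d⁺ Y v + y v)
      ≡⟨ trans (∑-distrib-+ (λ v → y v * d⁺ Y v + y v * d⁺ Y v) y)
               (cong (_+ ∑[ v < n ] y v) (∑-distrib-+ (λ v → y v * d⁺ Y v) _)) ⟩
    ∑[ v < n ] (y v * d⁺ Y v) + ∑[ v < n ] (y v * d⁺ Y v) + ∑[ v < n ] y v
      ≡⟨ cong (λ s → ∑[ v < n ] (y v * d⁺ Y v) + s + ∑[ v < n ] y v) (∑d⁺≡∑d⁻ Y) ⟩
    ∑[ v < n ] (y v * d⁺ Y v) + ∑[ v < n ] (y v * d⁻ Y v) + ∑[ v < n ] y v
      ≡⟨ trans (∑-distrib-+ (λ v → y v * d⁺ Y v + y v * d⁻ Y v) y)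
               (cong (_+ ∑[ v < n ] y v) (∑-distrib-+ (λ v → y v * d⁺ Y v) _)) ⟨
    ∑[ v < n ] (y v * d⁺ Y v + y v * d⁻ Y v + y v)
      ≡⟨ sum-cong-≗ (λ v → distrib (y v) (d⁺ Y v) (d⁻ Y v)) ⟩
    ∑[ v < n ] (y v * (d⁺ Y v + d⁻ Y v + 1))
      ≡⟨ ∑χ-cong Y d⁺+d⁻+1≡∣Y∣ ⟩
    ∑[ v < n ] (y v * ∣ Y ∣)
      ≡⟨ ∑χ-const Y ∣ Y ∣ ⟩
    ∣ Y ∣ * ∣ Y ∣ ∎
    where
    open ≡-Reasoning
    y = χ Y
    twice : ∀ a s → a * (2 * s + 1) ≡ a * s + a * s + a
    twice = solve-∀
    distrib : ∀ a s s′ → a * s + a * s′ + a ≡ a * (s + s′ + 1)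
    distrib = solve-∀

  ∃-d⁺≥ : (Y : Subset n) → Nonempty Y → ∃[ v ] (v ∈ Y × ∣ Y ∣ ≤ 2 * d⁺ Y v + 1)
  ∃-d⁺≥ Y ne = ∃-≥-average Y (λ v → 2 * d⁺ Y v + 1) ∣ Y ∣ ne (≤-reflexive (sym (∑-2d⁺+1 Y)))

  ∃-d⁺≤ : (Y : Subset n) → Nonempty Y → ∃[ v ] (v ∈ Y × 2 * d⁺ Y v + 1 ≤ ∣ Y ∣)
  ∃-d⁺≤ Y ne = ∃-≤-average Y (λ v → 2 * d⁺ Y v + 1) ∣ Y ∣ ne (≤-reflexive (∑-2d⁺+1 Y))

  d⁺-mono : {S S′ : Subset n} → S ⊆ S′ → (u : Fin n) → d⁺ S u ≤ d⁺ S′ u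
  d⁺-mono {S} {S′} S⊆S′ u = p⊆q⇒∣p∣≤∣q∣ λ x∈S∩N⁺ →
    let x∈S , x∈N⁺ = x∈p∩q⁻ S (N⁺ u) x∈S∩N⁺ in x∈p∩q⁺ (S⊆S′ x∈S , x∈N⁺)


  low high : Subset n → ℕ → Subset n
  low  S t = S ∩ below (d⁺ S) t
  high S t = S ∩ ∁ (below (d⁺ S) t)

  ∈-low⁻ : {S : Subset n} {t : ℕ} {x : Fin n} → x ∈ low S t → x ∈ S × d⁺ S x < t
  ∈-low⁻ {S} x∈low = let x∈S , x∈below = x∈p∩q⁻ S _ x∈low in x∈S , ∈-below⁻ x∈below

  ∈-high⁻ : {S : Subset n} {t : ℕ} {x : Fin n} → x ∈ high S t → x ∈ S × t ≤ d⁺ S x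
  ∈-high⁻ {S} x∈high = let x∈S , x∉below = x∈p∩q⁻ S _ x∈high in x∈S , ≮⇒≥ (x∈∁p⇒x∉p x∉below ∘ ∈-below⁺)

  ∈-high⁺ : {S : Subset n} {t : ℕ} {x : Fin n} → x ∈ S → t ≤ d⁺ S x → x ∈ high S t
  ∈-high⁺ x∈S t≤d⁺ = x∈p∩q⁺ (x∈S , x∉p⇒x∈∁p (≤⇒≯ t≤d⁺ ∘ ∈-below⁻))

  ∣low∣<2t : (S : Subset n) {t : ℕ} → 1 ≤ t → ∣ low S t ∣ < 2 * t
  ∣low∣<2t S {t} 1≤t with nonempty? (low S t)
  ... | no  empty = subst (_< 2 * t) (sym (Empty⇒∣p∣≡0 empty)) (≤-trans 1≤t (m≤m+n t (t + 0)))
  ... | yes ne = let v , v∈low , ∣low∣≤ = ∃-d⁺≥ (low S t) ne in begin-strict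
    ∣ low S t ∣                ≤⟨ ∣low∣≤ ⟩
    2 * d⁺ (low S t) v + 1     ≤⟨ +-monoˡ-≤ 1 (*-monoʳ-≤ 2 (d⁺-mono (p∩q⊆p S _) v)) ⟩
    2 * d⁺ S v + 1             <⟨ ≤-trans (≤-reflexive (suc[2m+1]≡2[1+m] _))
                                          (*-monoʳ-≤ 2 (proj₂ (∈-low⁻ {S} {t} v∈low))) ⟩
    2 * t                      ∎
    where
    open ≤-Reasoning

  ∣⊆∁high⊤∣<2t : {X : Subset n} {t : ℕ} → 1 ≤ t → X ⊆ ∁ (high ⊤ t) → ∣ X ∣ < 2 * t
  ∣⊆∁high⊤∣<2t {X} {t} 1≤t X⊆∁high = ≤-<-trans (p⊆q⇒∣p∣≤∣q∣ X⊆low) (∣low∣<2t ⊤ 1≤t)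
    where
    X⊆low : X ⊆ low ⊤ t
    X⊆low x∈X = x∈p∩q⁺ (∈⊤ , ∈-below⁺ {f = d⁺ ⊤} (≰⇒> (x∈∁p⇒x∉p (X⊆∁high x∈X) ∘ ∈-high⁺ {⊤} {t} ∈⊤)))

  module _ (S : Subset n) {t : ℕ} (1≤t : 1 ≤ t) (2t≤∣S∣ : 2 * t ≤ ∣ S ∣) where

    high-nonempty : Nonempty (high S t)
    high-nonempty = 0<∣p∣⇒Nonempty (+-cancelˡ-< ∣ low S t ∣ 0 _ (begin-strict
      ∣ low S t ∣ + 0             ≡⟨ +-identityʳ _ ⟩
      ∣ low S t ∣                 <⟨ ∣low∣<2t S 1≤t ⟩
      2 * t                       ≤⟨ 2t≤∣S∣ ⟩
      ∣ S ∣                       ≡⟨ ∣p∣-split S (below (d⁺ S) t) ⟩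
      ∣ low S t ∣ + ∣ high S t ∣  ∎))
      where open ≤-Reasoning

    ∃-moderate-high : ∃[ z ] (z ∈ high S t × 2 * d⁺ S z ≤ ∣ S ∣ + 2 * t)
    ∃-moderate-high =
      let z , z∈high , 2d⁺+1≤∣high∣ = ∃-d⁺≤ (high S t) high-nonempty in z , z∈high , (begin
      2 * d⁺ S z                                  ≡⟨ cong (2 *_) (∣p∩r∣-split S (below (d⁺ S) t) (N⁺ z)) ⟩
      2 * (d⁺ (low S t) z + d⁺ (high S t) z)      ≡⟨ *-distribˡ-+ 2 (d⁺ (low S t) z) _ ⟩
      2 * d⁺ (low S t) z + 2 * d⁺ (high S t) z    ≤⟨ +-mono-≤ (*-monoʳ-≤ 2 (∣p∩q∣≤∣p∣ (low S t) (N⁺ z)))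
                                                             (≤-trans (m≤m+n _ 1) 2d⁺+1≤∣high∣) ⟩
      2 * ∣ low S t ∣ + ∣ high S t ∣              ≡⟨ rearrange ∣ low S t ∣ ∣ high S t ∣ ⟩
      ∣ low S t ∣ + ∣ high S t ∣ + ∣ low S t ∣    ≡⟨ cong (_+ ∣ low S t ∣) (∣p∣-split S (below (d⁺ S) t)) ⟨
      ∣ S ∣ + ∣ low S t ∣                         ≤⟨ +-monoʳ-≤ ∣ S ∣ (<⇒≤ (∣low∣<2t S 1≤t)) ⟩
      ∣ S ∣ + 2 * t                               ∎)
      where
      open ≤-Reasoning
      rearrange : ∀ a b → 2 * a + b ≡ a + b + a
      rearrange = solve-∀

    ∃-min-high : ∃[ a ] (a ∈ high S t × (∀ {v} → v ∈ high S t → d⁺ S a ≤ d⁺ S v)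
                         × 2 * d⁺ S a ≤ ∣ S ∣ + 2 * t)
    ∃-min-high =
      let a , a∈high , a-min = ∃-argmin (d⁺ S) high-nonempty
          z , z∈high , z-moderate = ∃-moderate-high
      in a , a∈high , a-min , ≤-trans (*-monoʳ-≤ 2 (a-min z∈high)) z-moderate

  -- Transitive chains

  Chain : {k : ℕ} → (Fin k → Fin n) → Set
  Chain w = ∀ {i j} → i Fin.< j → Edge T (w i) (w j)

  chain-∷ : {k : ℕ} {x : Fin n} {w : Fin k → Fin n} →
            (∀ i → Edge T x (w i)) → Chain w → Chain (x Vector.∷ w)
  chain-∷ x→w cw {zero}  {suc j} _         = x→w j
  chain-∷ x→w cw {suc i} {suc j} (s≤s i<j) = cw i<j

  chain-injective : {k : ℕ} {w : Fin k → Fin n} → Chain w → Injective _≡_ _≡_ w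
  chain-injective {w = w} cw {i} {j} wᵢ≡wⱼ with Finₚ.<-cmp i j
  ... | tri< i<j _ _ = contradiction (subst (Edge T (w i)) (sym wᵢ≡wⱼ) (cw i<j)) edge-irrefl
  ... | tri≈ _ i≡j _ = i≡j
  ... | tri> _ _ j<i = contradiction (subst (Edge T (w j)) wᵢ≡wⱼ (cw j<i)) edge-irrefl

  chain-edge⇔< : {k : ℕ} {w : Fin k → Fin n} → Chain w → ∀ i j → Edge T (w i) (w j) ⇔ i Fin.< j
  chain-edge⇔< {w = w} cw i j = mk⇔ edge⇒< cw
    where
    edge⇒< : Edge T (w i) (w j) → i Fin.< j
    edge⇒< wᵢwⱼ with Finₚ.<-cmp i j
    ... | tri< i<j _ _  = i<j
    ... | tri≈ _ refl _ = contradiction wᵢwⱼ edge-irrefl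
    ... | tri> _ _ j<i  = contradiction (cw j<i) (edge-asym wᵢwⱼ)

  chain-++ : {k l : ℕ} {a : Fin k → Fin n} {b : Fin l → Fin n} → Chain a → Chain b →
             (∀ i j → Edge T (a i) (b j)) → Chain (a ++ b)
  chain-++ {k} {l} {a} {b} ca cb a→b {i} {j} i<j with ↑ˡ-or-↑ʳ {k} {l} i | ↑ˡ-or-↑ʳ {k} {l} j
  ... | inj₁ (x , refl) | inj₁ (y , refl) rewrite lookup-++ˡ a b x | lookup-++ˡ a b y =
    ca (subst₂ _<_ (Finₚ.toℕ-↑ˡ x l) (Finₚ.toℕ-↑ˡ y l) i<j)
  ... | inj₁ (x , refl) | inj₂ (y , refl) rewrite lookup-++ˡ a b x | lookup-++ʳ a b y = a→b x y
  ... | inj₂ (x , refl) | inj₁ (y , refl) = contradiction (Finₚ.toℕ<n y) (≤⇒≯ (begin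
    k                  ≤⟨ m≤m+n k (Fin.toℕ x) ⟩
    k + Fin.toℕ x      ≡⟨ Finₚ.toℕ-↑ʳ k x ⟨
    Fin.toℕ (k ↑ʳ x)   ≤⟨ <⇒≤ i<j ⟩
    Fin.toℕ (y ↑ˡ l)   ≡⟨ Finₚ.toℕ-↑ˡ y l ⟩
    Fin.toℕ y          ∎))
    where open ≤-Reasoning
  ... | inj₂ (x , refl) | inj₂ (y , refl) rewrite lookup-++ʳ a b x | lookup-++ʳ a b y =
    cb (+-cancelˡ-< k _ _ (subst₂ _<_ (Finₚ.toℕ-↑ʳ k x) (Finₚ.toℕ-↑ʳ k y) i<j))

  transitive-tail-head : {k l : ℕ} {a : Fin (suc k) → Fin n} {b : Fin (suc l) → Fin n} →
                         Chain a → Chain b → (∀ i j → Edge T (a i) (b j)) →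
                         TransitiveTailHead T (image a ∪ image b) (image a) (image b)
  transitive-tail-head {k} {l} {a} {b} ca cb a→b =
    k + suc l , a ++ b , chain-injective chain , ∈-image-++ , chain-edge⇔< chain ,
    ∈-image⁺ a zero ,
    subst (_∈ image b) (trans (sym (lookup-++ʳ a b (Fin.fromℕ l))) last) (∈-image⁺ b (Fin.fromℕ l))
    where
    chain : Chain (a ++ b)
    chain = chain-++ ca cb a→b

    last : (a ++ b) (suc k ↑ʳ Fin.fromℕ l) ≡ (a ++ b) (Fin.fromℕ (k + suc l))
    last = cong (a ++ b) (Finₚ.toℕ-injective (begin
      Fin.toℕ (suc k ↑ʳ Fin.fromℕ l)   ≡⟨ Finₚ.toℕ-↑ʳ (suc k) (Fin.fromℕ l) ⟩
      suc k + Fin.toℕ (Fin.fromℕ l)    ≡⟨ cong (suc k +_) (Finₚ.toℕ-fromℕ l) ⟩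
      suc k + l                        ≡⟨ +-suc k l ⟨
      k + suc l                        ≡⟨ Finₚ.toℕ-fromℕ (k + suc l) ⟨
      Fin.toℕ (Fin.fromℕ (k + suc l))  ∎))
      where open ≡-Reasoning

    ∈-image-++ : ∀ x → x ∈ image a ∪ image b ⇔ (∃[ i ] ((a ++ b) i ≡ x))
    ∈-image-++ x = mk⇔ to from
      where
      to : x ∈ image a ∪ image b → ∃[ i ] ((a ++ b) i ≡ x)
      to x∈a∪b with x∈p∪q⁻ (image a) (image b) x∈a∪b
      ... | inj₁ x∈a = let i , aᵢ≡x = ∈-image⁻ a x∈a in i ↑ˡ suc l , trans (lookup-++ˡ a b i) aᵢ≡x
      ... | inj₂ x∈b = let j , bⱼ≡x = ∈-image⁻ b x∈b in suc k ↑ʳ j , trans (lookup-++ʳ a b j) bⱼ≡x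
      from : ∃[ i ] ((a ++ b) i ≡ x) → x ∈ image a ∪ image b
      from (i , wᵢ≡x) with ↑ˡ-or-↑ʳ {suc k} {suc l} i
      ... | inj₁ (i′ , refl) =
        x∈p∪q⁺ (inj₁ (subst (_∈ image a) (trans (sym (lookup-++ˡ a b i′)) wᵢ≡x) (∈-image⁺ a i′)))
      ... | inj₂ (j′ , refl) =
        x∈p∪q⁺ (inj₂ (subst (_∈ image b) (trans (sym (lookup-++ʳ a b j′)) wᵢ≡x) (∈-image⁺ b j′)))

  ∃-chain : (M : ℕ) (S : Subset n) → 2 ^ M ≤ suc ∣ S ∣ → ∃[ b ] (Chain {M} b × (∀ i → b i ∈ S))
  ∃-chain zero    S _ = (λ ()) , (λ { {()} }) , λ ()
  ∃-chain (suc M) S 2^[1+M]≤1+∣S∣ =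
    let v , v∈S , ∣S∣≤2d⁺+1 = ∃-d⁺≥ S (0<∣p∣⇒Nonempty (s≤s⁻¹ (≤-trans (*-monoʳ-≤ 2 (m^n>0 2 M)) 2^[1+M]≤1+∣S∣)))
        b , cb , b∈S∩N⁺ = ∃-chain M (S ∩ N⁺ v) (*-cancelˡ-≤ 2 (begin
          2 * 2 ^ M            ≤⟨ 2^[1+M]≤1+∣S∣ ⟩
          suc ∣ S ∣            ≤⟨ s≤s ∣S∣≤2d⁺+1 ⟩
          suc (2 * d⁺ S v + 1) ≡⟨ suc[2m+1]≡2[1+m] (d⁺ S v) ⟩
          2 * suc (d⁺ S v)     ∎))
    in v Vector.∷ b , chain-∷ (λ i → ∈N⁺⇒edge (proj₂ (x∈p∩q⁻ S _ (b∈S∩N⁺ i)))) cb ,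
       λ { zero → v∈S ; (suc i) → proj₁ (x∈p∩q⁻ S _ (b∈S∩N⁺ i)) }
    where open ≤-Reasoning

  record OutChain (S : Subset n) (k : ℕ) : Set where
    field
      chain          : Fin k → Fin n
      transitive     : Chain chain
      chain∈S        : ∀ i → chain i ∈ S
      common         : Subset n
      common⊆S       : common ⊆ S
      chain→common   : ∀ i {v} → v ∈ common → Edge T (chain i) v
      outside-common : ∀ {v} → v ∈ S → v ∉ common → ∃[ i ] ¬ Edge T (chain i) v

  open OutChain

  extend : {S : Subset n} {x : Fin n} {k : ℕ} → x ∈ S → OutChain (S ∩ N⁺ x) k → OutChain S (suc k)
  extend {S} {x} x∈S 𝒞 = record
    { chain          = x Vector.∷ chain 𝒞
    ; transitive     = chain-∷ (λ i → ∈N⁺⇒edge (proj₂ (∈S∩N⁺ (chain∈S 𝒞 i)))) (transitive 𝒞)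
    ; chain∈S        = λ { zero → x∈S ; (suc i) → proj₁ (∈S∩N⁺ (chain∈S 𝒞 i)) }
    ; common         = common 𝒞
    ; common⊆S       = proj₁ ∘ ∈S∩N⁺ ∘ common⊆S 𝒞
    ; chain→common   = λ { zero v∈C → ∈N⁺⇒edge (proj₂ (∈S∩N⁺ (common⊆S 𝒞 v∈C)))
                         ; (suc i) → chain→common 𝒞 i }
    ; outside-common = missed
    }
    where
    ∈S∩N⁺ : ∀ {v} → v ∈ S ∩ N⁺ x → v ∈ S × v ∈ N⁺ x
    ∈S∩N⁺ = x∈p∩q⁻ S (N⁺ x)
    missed : ∀ {v} → v ∈ S → v ∉ common 𝒞 → ∃[ i ] ¬ Edge T ((x Vector.∷ chain 𝒞) i) v
    missed {v} v∈S v∉C with adj T x v in xv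
    ... | false = zero , λ xv′ → contradiction (trans (sym xv′) xv) λ ()
    ... | true  = let i , ¬edge = outside-common 𝒞 (x∈p∩q⁺ (v∈S , edge⇒∈N⁺ xv)) v∉C in suc i , ¬edge

  outChain-in-dominates : {k : ℕ} (𝒞 : OutChain ⊤ k) {Y : Subset n} → common 𝒞 ⊆ Y →
                          InDominates T (image (chain 𝒞)) (∁ Y)
  outChain-in-dominates 𝒞 C⊆Y b b∈∁Y b∉A =
    let i , ¬aᵢb = outside-common 𝒞 ∈⊤ (x∈∁p⇒x∉p b∈∁Y ∘ C⊆Y)
        aᵢ∈A = ∈-image⁺ (chain 𝒞) i
    in chain 𝒞 i , aᵢ∈A , ¬edge⇒edge (λ aᵢ≡b → b∉A (subst (_∈ image (chain 𝒞)) aᵢ≡b aᵢ∈A)) ¬aᵢb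

  -- The vertex chosen by ∃-min-high with threshold t = 2^(M+k) has between t and (∣S∣ + 2t)/2
  -- out-neighbours in S; the bound on ∣common∣ accumulates these halvings.
  ∃-outChain : (M k : ℕ) (S : Subset n) → 2 ^ (M + k) ≤ ∣ S ∣ →
               Σ (OutChain S k) λ 𝒞 → 2 ^ M ≤ ∣ common 𝒞 ∣ × 2 ^ k * ∣ common 𝒞 ∣ ≤ ∣ S ∣ + k * 2 ^ (M + k)
  ∃-outChain M zero S 2^M≤∣S∣ =
    record { chain = λ () ; transitive = λ { {()} } ; chain∈S = λ ()
           ; common = S ; common⊆S = id ; chain→common = λ ()
           ; outside-common = λ v∈S v∉S → contradiction v∈S v∉S } ,
    subst (_≤ ∣ S ∣) (cong (2 ^_) (+-identityʳ M)) 2^M≤∣S∣ ,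
    ≤-reflexive (trans (*-identityˡ ∣ S ∣) (sym (+-identityʳ ∣ S ∣)))
  ∃-outChain M (suc k) S 2^[M+1+k]≤∣S∣ =
    let a , a∈high , _ , 2d⁺≤∣S∣+2t = ∃-min-high S (m^n>0 2 (M + k)) 2t≤∣S∣
        a∈S , t≤d⁺ = ∈-high⁻ {S} a∈high
        𝒞 , large , bound = ∃-outChain M k (S ∩ N⁺ a) t≤d⁺
    in extend a∈S 𝒞 , large ,
       subst (λ z → 2 * 2 ^ k * ∣ common 𝒞 ∣ ≤ ∣ S ∣ + suc k * z) (sym 2^[M+1+k]≡2t)
             (halve (2 ^ k) (∣ common 𝒞 ∣) (d⁺ S a) (∣ S ∣) (2 ^ (M + k)) k bound 2d⁺≤∣S∣+2t)
    where
    2^[M+1+k]≡2t : 2 ^ (M + suc k) ≡ 2 * 2 ^ (M + k)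
    2^[M+1+k]≡2t = cong (2 ^_) (+-suc M k)

    2t≤∣S∣ : 2 * 2 ^ (M + k) ≤ ∣ S ∣
    2t≤∣S∣ = subst (_≤ ∣ S ∣) 2^[M+1+k]≡2t 2^[M+1+k]≤∣S∣

    halve : ∀ x c d s t j → x * c ≤ d + j * t → 2 * d ≤ s + 2 * t → 2 * x * c ≤ s + suc j * (2 * t)
    halve x c d s t j xc≤d+jt 2d≤s+2t = begin
      2 * x * c                ≡⟨ *-assoc 2 x c ⟩
      2 * (x * c)              ≤⟨ *-monoʳ-≤ 2 xc≤d+jt ⟩
      2 * (d + j * t)          ≡⟨ *-distribˡ-+ 2 d (j * t) ⟩
      2 * d + 2 * (j * t)      ≤⟨ +-monoˡ-≤ (2 * (j * t)) 2d≤s+2t ⟩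
      s + 2 * t + 2 * (j * t)  ≡⟨ regroup s t j ⟩
      s + suc j * (2 * t)      ∎
      where
      open ≤-Reasoning
      regroup : ∀ s t j → s + 2 * t + 2 * (j * t) ≡ s + suc j * (2 * t)
      regroup = solve-∀

  -- The first vertex has least out-degree d among the vertices of out-degree ≥ 2^(M+m′).
  ∃-outChain-with-threshold : (M m′ : ℕ) → 2 * 2 ^ (M + m′) ≤ n →
    Σ (OutChain ⊤ (suc m′)) λ 𝒞 → ∃[ d ]
      ( 2 ^ M ≤ ∣ common 𝒞 ∣
      × 2 ^ m′ * (∣ common 𝒞 ∣ ∸ m′ * 2 ^ M) ≤ d
      × (∀ {u} → u ∈ high ⊤ (2 ^ (M + m′)) → d ≤ outDeg T u))
  ∃-outChain-with-threshold M m′ 2t≤n =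
    let a , a∈high , a-min , _ = ∃-min-high ⊤ (m^n>0 2 (M + m′)) (subst (2 * 2 ^ (M + m′) ≤_) (sym (∣⊤∣≡n n)) 2t≤n)
        𝒞 , large , bound = ∃-outChain M m′ (⊤ ∩ N⁺ a) (proj₂ (∈-high⁻ {⊤} a∈high))
    in extend ∈⊤ 𝒞 , d⁺ ⊤ a , large ,
       m*n≤o+m*p⇒m*[n∸p]≤o (2 ^ m′) (∣ common 𝒞 ∣) (m′ * 2 ^ M) (d⁺ ⊤ a)
         (subst (λ z → 2 ^ m′ * ∣ common 𝒞 ∣ ≤ d⁺ ⊤ a + z) (regroup M m′) bound) ,
       λ {u} u∈high → subst (d⁺ ⊤ a ≤_) (d⁺⊤≡outDeg u) (a-min u∈high)
    where
    regroup : ∀ M m′ → m′ * 2 ^ (M + m′) ≡ 2 ^ m′ * (m′ * 2 ^ M)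
    regroup M m′ = begin
      m′ * 2 ^ (M + m′)      ≡⟨ cong (m′ *_) (^-distribˡ-+-* 2 M m′) ⟩
      m′ * (2 ^ M * 2 ^ m′)  ≡⟨ rotate m′ (2 ^ M) (2 ^ m′) ⟩
      2 ^ m′ * (m′ * 2 ^ M)  ∎
      where
      open ≡-Reasoning
      rotate : ∀ a x y → a * (x * y) ≡ y * (a * x)
      rotate = solve-∀

open OutChain

lemma3p8 : (m M L p : ℕ) → 1 ≤ m → 1 ≤ M → 2 ^ (m + M) ≤ L → p ≤ 2 ^ (m ∸ 1) →
    (n : ℕ) → (T : Tournament n) → L ≤ n →
    ∃[ A ] ∃[ B ] ∃[ E⁻ ] ∃[ X ]
    ( TransitiveTailHead T (A ∪ B) A B
    × ∣ A ∣ ≡ m × ∣ B ∣ ≡ M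
    × InDominates T A (∁ (E⁻ ∪ X))
    × ∣ X ∣ ≤ L
    × (∀ u → u ∈ E⁻ → p * ∣ E⁻ ∣ ≤ outDeg T u) )
lemma3p8 zero     _        _ _ () _  _ _ _ _ _
lemma3p8 (suc m′) zero     _ _ _  () _ _ _ _ _
lemma3p8 (suc m′) (suc M′) L p _  _  2^[m+M]≤L p≤2^m′ n T L≤n =
  let M = suc M′
      t = 2 ^ (M + m′)
      2t≤L = subst (_≤ L) (2^[1+m+k]≡2*2^[k+m] m′ M) 2^[m+M]≤L
      𝒞 , d , large , excess , high⇒d≤deg = ∃-outChain-with-threshold T M m′ (≤-trans 2t≤L L≤n)
      C = common 𝒞
      b , cb , b∈C = ∃-chain T M C (≤-trans large (n≤1+n _))
      E , E⊆C∩high , ∣E∣≤r , few-or-low = ∃-truncation C (high T ⊤ t) (∣ C ∣ ∸ m′ * 2 ^ M)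
      X = C ∩ ∁ E
  in image (chain 𝒞) , image b , E , X ,
     transitive-tail-head T (transitive 𝒞) cb (λ i j → chain→common 𝒞 i (b∈C j)) ,
     ∣image∣ (chain 𝒞) (chain-injective T (transitive 𝒞)) , ∣image∣ b (chain-injective T cb) ,
     outChain-in-dominates T 𝒞 (p⊆q∪[p∩∁q] C E) ,
     [ (λ ∣X∣+r≤∣C∣ → ≤-trans (m+[n∸o]≤n⇒m≤o ∣ X ∣ ∣ C ∣ (m′ * 2 ^ M) ∣X∣+r≤∣C∣)
                              (≤-trans (m*2^k≤2^[1+m+k] m′ M) 2^[m+M]≤L))
     , (λ (X⊆low : X ⊆ ∁ (high T ⊤ t)) → ≤-trans (<⇒≤ (∣⊆∁high⊤∣<2t T (m^n>0 2 (M + m′)) X⊆low)) 2t≤L)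
     ]′ few-or-low ,
     λ u u∈E → ≤-trans (*-mono-≤ p≤2^m′ ∣E∣≤r)
                       (≤-trans excess (high⇒d≤deg (proj₂ (x∈p∩q⁻ C _ (E⊆C∩high u∈E)))))
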